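{- Let $G\in\mathfrak{Gr}(n,k)$ with $k\ge 2$, and let $s$ be an integer with $$\frac{\log\binom{n+1}{2}}{\log\bigl(n/(k-1)\bigr)}<s\le n.$$ Then there exists an identifying set of $s$ vertices of $G$.
   Context: All graphs are finite, simple and undirected. For a graph $G=(V,E)$ and $x\in V$, $N[x]=\{x\}\cup\{y: xy\in E\}$. A set $C\subseteq V$ is identifying if $N[x]\cap C\ne\emptyset$ for every $x\in V$ and $N[x]\cap C\neq N[y]\cap C$ for all distinct $x,y\in V$. For $n\ge k\ge1$, $\mathfrak{Gr}(n,k)$ is the set of graphs on $n$ vertices in which every $k$-element subset of vertices is identifying. -}

module Defs where

open import Data.Nat using (ℕ; suc; _≤_; _<_; _*_; _∸_; _^_)
open import Data.Nat.Combinatorics using (_C_)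
open import Data.Bool using (Bool; true; false; _∨_)
open import Data.Fin using (Fin; _≟_)
open import Data.Fin.Subset using (Subset; _∩_; ∣_∣; Nonempty)
open import Data.Vec using (tabulate)
open import Data.Product using (_×_)
open import Relation.Nullary.Decidable using (⌊_⌋)
open import Relation.Binary.PropositionalEquality using (_≡_; _≢_)

record Graph (n : ℕ) : Set where
  field
    adj     : Fin n → Fin n → Bool
    adj-sym : ∀ x y → adj x y ≡ adj y x
    adj-irr : ∀ x → adj x x ≡ false
open Graph public

N[_]_ : ∀ {n} → Fin n → Graph n → Subset n
N[ x ] G = tabulate (λ y → ⌊ x ≟ y ⌋ ∨ adj G x y)

Identifying : ∀ {n} → Graph n → Subset n → Set
Identifying {n} G C =
  (∀ (x : Fin n) → Nonempty ((N[ x ] G) ∩ C)) ×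
  (∀ (x y : Fin n) → x ≢ y → (N[ x ] G) ∩ C ≢ (N[ y ] G) ∩ C)

InGr : (n k : ℕ) → Graph n → Set
InGr n k G = (k ≤ n) × (1 ≤ k) × (∀ (C : Subset n) → ∣ C ∣ ≡ k → Identifying G C)

-- A vertex z separates the pair x ≤ y if z ∈ N[x] (when x = y) or z ∈ N[x] ∆ N[y]
-- (when x ≠ y), and a set is identifying exactly when it separates all C(n+1,2) pairs.
-- If some pair had k non-separators, they would form a non-identifying k-set; so every
-- pair has at most k − 1 of them. Greedily add the vertex missed by the fewest pairs
-- not yet separated: by averaging, at most a fraction (k − 1)/n of those pairs survive
-- each step, so after s steps fewer than C(n+1,2) ((k − 1)/n)^s < 1 remain. The at most
-- s vertices chosen are then padded to exactly s vertices.
module Submission where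

open import Defs
open import Data.Bool using (Bool; true; false; _∧_; _xor_; T)
open import Data.Bool.Properties using (xor-same; xor-identityʳ)
open import Data.Fin as Fin using (Fin; zero; suc; _≟_)
open import Data.Fin.Properties as Fin using ()
open import Data.Fin.Subset
  using (Subset; inside; outside; ∣_∣; _∈_; _⊆_; ⊥; ∁; _∩_; _∪_; ⁅_⁆; Nonempty)
open import Data.Fin.Subset.Properties
  using (∉⊥; ⊥⊆; ⊆⊤; ∣⊥∣≡0; ∣⊤∣≡n; ∣⁅x⁆∣≡1; ∣p∣≤∣x∷p∣; x∈⁅x⁆; x∈p∩q⁺; x∈p∩q⁻;
         x∈p∪q⁺; p⊆p∪q; x∈∁p⇒x∉p; x∉∁p⇒x∈p; s⊆s; out⊆; drop-∷-⊆)
open import Data.List using (List; []; _∷_; length; map; _++_; allFin; filterᵇ)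
open import Data.List.Extrema.Nat using (argmin; f[argmin]≤f[xs])
open import Data.List.Membership.Propositional using () renaming (_∈_ to _∈ₗ_)
open import Data.List.Membership.Propositional.Properties
  using (∈-allFin; ∈-map⁺; ∈-++⁺ˡ; ∈-++⁺ʳ; ∈-filter⁺)
open import Data.List.Properties using (length-map; length-++; length-tabulate)
open import Data.List.Relation.Unary.All as All using ()
open import Data.Nat
  using (ℕ; zero; suc; _≤_; _<_; _+_; _*_; _∸_; _^_; z≤n; s≤s; _≤?_)
open import Data.Nat.Combinatorics using (_C_; nC1≡n; nCk+nC[k+1]≡[n+1]C[k+1])
open import Data.Nat.Properties
  using (+-0-commutativeMonoid; ≤-trans; ≤-reflexive; ≤-antisym; ≰⇒>; ≮⇒≥; <⇒≱;
         m≤m*n; +-mono-≤; +-monoʳ-≤; *-monoʳ-≤; *-monoˡ-≤; +-suc; +-comm; *-assoc; *-comm;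
         module ≤-Reasoning)
open import Algebra.Properties.CommutativeMonoid.Sum +-0-commutativeMonoid
  using (sum-syntax; ∑-distrib-+; sum-cong-≗; sum-replicate-zero)
open import Data.Product as Prod using (∃; _×_; _,_; proj₁; proj₂)
open import Data.Sum using (_⊎_; inj₁; inj₂; [_,_]′)
open import Data.Unit using (tt)
open import Data.Vec using (_∷_; []; lookup; zipWith; here; there)
open import Data.Vec.Properties using ([]=⇒lookup)
open import Function using (_∘_; id)
open import Relation.Nullary using (¬_; yes; no; contradiction)
open import Relation.Nullary.Decidable using (T?)
open import Relation.Binary.PropositionalEquality
  using (_≡_; _≢_; refl; sym; trans; cong; cong₂; subst; module ≡-Reasoning)

𝟙 : Bool → ℕ
𝟙 true  = 1
𝟙 false = 0

*≤∑ : ∀ {n c} (f : Fin n → ℕ) → (∀ z → c ≤ f z) → n * c ≤ ∑[ z < n ] f z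
*≤∑ {zero}  f c≤f = z≤n
*≤∑ {suc n} f c≤f = +-mono-≤ (c≤f zero) (*≤∑ (f ∘ suc) (c≤f ∘ suc))

∃-*≤∑ : ∀ {n} (f : Fin (suc n) → ℕ) → ∃ λ z → suc n * f z ≤ ∑[ w < suc n ] f w
∃-*≤∑ {n} f = z , *≤∑ f z-minimal
  where
  z : Fin (suc n)
  z = argmin f zero (allFin (suc n))

  z-minimal : ∀ w → f z ≤ f w
  z-minimal w = All.lookup (f[argmin]≤f[xs] {f = f} zero (allFin (suc n))) (∈-allFin w)

*-bound-trans : ∀ {a B c n N K M} → n * a ≤ B * K → N * B ≤ c * M → (n * N) * a ≤ c * (K * M)
*-bound-trans {a} {B} {c} {n} {N} {K} {M} na≤BK NB≤cM = begin
  (n * N) * a  ≡⟨ cong (_* a) (*-comm n N) ⟩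
  (N * n) * a  ≡⟨ *-assoc N n a ⟩
  N * (n * a)  ≤⟨ *-monoʳ-≤ N na≤BK ⟩
  N * (B * K)  ≡⟨ sym (*-assoc N B K) ⟩
  (N * B) * K  ≤⟨ *-monoˡ-≤ K NB≤cM ⟩
  (c * M) * K  ≡⟨ *-assoc c M K ⟩
  c * (M * K)  ≡⟨ cong (c *_) (*-comm M K) ⟩
  c * (K * M)  ∎
  where open ≤-Reasoning

∣p∣≡∑𝟙 : ∀ {n} (p : Subset n) → ∣ p ∣ ≡ ∑[ z < n ] 𝟙 (lookup p z)
∣p∣≡∑𝟙 []            = refl
∣p∣≡∑𝟙 (inside ∷ p)  = cong suc (∣p∣≡∑𝟙 p)
∣p∣≡∑𝟙 (outside ∷ p) = ∣p∣≡∑𝟙 p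

∣p∪q∣≤∣p∣+∣q∣ : ∀ {n} (p q : Subset n) → ∣ p ∪ q ∣ ≤ ∣ p ∣ + ∣ q ∣
∣p∪q∣≤∣p∣+∣q∣ []            []            = z≤n
∣p∪q∣≤∣p∣+∣q∣ (inside ∷ p)  (b ∷ q)       =
  s≤s (≤-trans (∣p∪q∣≤∣p∣+∣q∣ p q) (+-monoʳ-≤ ∣ p ∣ (∣p∣≤∣x∷p∣ b q)))
∣p∪q∣≤∣p∣+∣q∣ (outside ∷ p) (inside ∷ q)  =
  ≤-trans (s≤s (∣p∪q∣≤∣p∣+∣q∣ p q)) (≤-reflexive (sym (+-suc ∣ p ∣ ∣ q ∣)))
∣p∪q∣≤∣p∣+∣q∣ (outside ∷ p) (outside ∷ q) = ∣p∪q∣≤∣p∣+∣q∣ p q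

∣p∪⁅x⁆∣≤1+∣p∣ : ∀ {n} (p : Subset n) x → ∣ p ∪ ⁅ x ⁆ ∣ ≤ suc ∣ p ∣
∣p∪⁅x⁆∣≤1+∣p∣ p x = begin
  ∣ p ∪ ⁅ x ⁆ ∣     ≤⟨ ∣p∪q∣≤∣p∣+∣q∣ p ⁅ x ⁆ ⟩
  ∣ p ∣ + ∣ ⁅ x ⁆ ∣  ≡⟨ cong (∣ p ∣ +_) (∣⁅x⁆∣≡1 x) ⟩
  ∣ p ∣ + 1         ≡⟨ +-comm ∣ p ∣ 1 ⟩
  suc ∣ p ∣         ∎
  where open ≤-Reasoning

Nonempty-∩-mono : ∀ {n} {p q r : Subset n} → q ⊆ r → Nonempty (p ∩ q) → Nonempty (p ∩ r)
Nonempty-∩-mono {p = p} {q} q⊆r (z , z∈p∩q) with x∈p∩q⁻ p q z∈p∩q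
... | z∈p , z∈q = z , x∈p∩q⁺ (z∈p , q⊆r z∈q)

lookup-∁≡false⇒∈ : ∀ {n} {p : Subset n} {z} → lookup (∁ p) z ≡ false → z ∈ p
lookup-∁≡false⇒∈ ∁p[z]≡false =
  x∉∁p⇒x∈p (λ z∈∁p → contradiction (trans (sym ([]=⇒lookup z∈∁p)) ∁p[z]≡false) λ ())

⊆-interpolate : ∀ {n} {p r : Subset n} m → p ⊆ r → ∣ p ∣ ≤ m → m ≤ ∣ r ∣ →
  ∃ λ q → p ⊆ q × q ⊆ r × ∣ q ∣ ≡ m
⊆-interpolate {p = []} {[]} zero _ _ _ = [] , id , id , refl
⊆-interpolate {p = inside ∷ p} {outside ∷ r} m p⊆r _ _ with p⊆r here
... | ()
⊆-interpolate {p = inside ∷ p} {inside ∷ r} (suc m) p⊆r (s≤s ∣p∣≤m) (s≤s m≤∣r∣)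
  with ⊆-interpolate m (drop-∷-⊆ p⊆r) ∣p∣≤m m≤∣r∣
... | q , p⊆q , q⊆r , ∣q∣≡m = inside ∷ q , s⊆s p⊆q , s⊆s q⊆r , cong suc ∣q∣≡m
⊆-interpolate {p = outside ∷ p} {outside ∷ r} m p⊆r ∣p∣≤m m≤∣r∣
  with ⊆-interpolate m (drop-∷-⊆ p⊆r) ∣p∣≤m m≤∣r∣
... | q , p⊆q , q⊆r , ∣q∣≡m = outside ∷ q , s⊆s p⊆q , s⊆s q⊆r , ∣q∣≡m
⊆-interpolate {p = outside ∷ p} {inside ∷ r} m p⊆r ∣p∣≤m m≤1+∣r∣ with m ≤? ∣ r ∣
... | yes m≤∣r∣ with ⊆-interpolate m (drop-∷-⊆ p⊆r) ∣p∣≤m m≤∣r∣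
...   | q , p⊆q , q⊆r , ∣q∣≡m = outside ∷ q , s⊆s p⊆q , out⊆ q⊆r , ∣q∣≡m
⊆-interpolate {p = outside ∷ p} {inside ∷ r} m p⊆r ∣p∣≤m m≤1+∣r∣ | no m≰∣r∣ =
  inside ∷ r , p⊆r , id , ≤-antisym (≰⇒> m≰∣r∣) m≤1+∣r∣

infixr 6 _∆_
_∆_ : ∀ {n} → Subset n → Subset n → Subset n
_∆_ = zipWith _xor_

∩-distribʳ-∆ : ∀ {n} (p q r : Subset n) → (p ∆ q) ∩ r ≡ (p ∩ r) ∆ (q ∩ r)
∩-distribʳ-∆ []            []       []       = refl
∩-distribʳ-∆ (outside ∷ p) (b ∷ q)  (c ∷ r)  = cong (b ∧ c ∷_) (∩-distribʳ-∆ p q r)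
∩-distribʳ-∆ (inside ∷ p)  (inside ∷ q)  (c ∷ r) =
  cong₂ _∷_ (sym (xor-same c)) (∩-distribʳ-∆ p q r)
∩-distribʳ-∆ (inside ∷ p)  (outside ∷ q) (c ∷ r) =
  cong₂ _∷_ (sym (xor-identityʳ c)) (∩-distribʳ-∆ p q r)

≢⇒Nonempty-∆ : ∀ {n} {p q : Subset n} → p ≢ q → Nonempty (p ∆ q)
≢⇒Nonempty-∆ {p = []}          {[]}          p≢q = contradiction refl p≢q
≢⇒Nonempty-∆ {p = inside ∷ p}  {outside ∷ q} _   = zero , here
≢⇒Nonempty-∆ {p = outside ∷ p} {inside ∷ q}  _   = zero , here
≢⇒Nonempty-∆ {p = inside ∷ p}  {inside ∷ q}  p≢q with ≢⇒Nonempty-∆ (p≢q ∘ cong (inside ∷_))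
... | z , z∈p∆q = suc z , there z∈p∆q
≢⇒Nonempty-∆ {p = outside ∷ p} {outside ∷ q} p≢q with ≢⇒Nonempty-∆ (p≢q ∘ cong (outside ∷_))
... | z , z∈p∆q = suc z , there z∈p∆q

p∆p≡⊥ : ∀ {n} (p : Subset n) → p ∆ p ≡ ⊥
p∆p≡⊥ []      = refl
p∆p≡⊥ (b ∷ p) = cong₂ _∷_ (xor-same b) (p∆p≡⊥ p)

Nonempty-∆⇒≢ : ∀ {n} {p q : Subset n} → Nonempty (p ∆ q) → p ≢ q
Nonempty-∆⇒≢ {p = p} (z , z∈p∆p) refl = ∉⊥ (subst (z ∈_) (p∆p≡⊥ p) z∈p∆p)

length-filterᵇ-∷ : ∀ {A : Set} (P : A → Bool) u us →
  length (filterᵇ P (u ∷ us)) ≡ 𝟙 (P u) + length (filterᵇ P us)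
length-filterᵇ-∷ P u us with P u
... | true  = refl
... | false = refl

∈-filterᵇ⊎rejected : ∀ {A : Set} (P : A → Bool) {u us} → u ∈ₗ us →
  u ∈ₗ filterᵇ P us ⊎ P u ≡ false
∈-filterᵇ⊎rejected P {u} u∈us with P u in Pu≡
... | true  = inj₁ (∈-filter⁺ (T? ∘ P) u∈us (subst T (sym Pu≡) tt))
... | false = inj₂ refl

∑-length-filterᵇ≤ : ∀ {A : Set} {n b} (f : A → Subset n) → (∀ u → ∣ f u ∣ ≤ b) →
  (us : List A) → ∑[ z < n ] length (filterᵇ (λ u → lookup (f u) z) us) ≤ length us * b
∑-length-filterᵇ≤ {n = n} f ∣f∣≤b [] = ≤-reflexive (sum-replicate-zero n)
∑-length-filterᵇ≤ {A} {n} {b} f ∣f∣≤b (u ∷ us) = begin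
  ∑[ z < n ] length (filterᵇ (member z) (u ∷ us))
    ≡⟨ sum-cong-≗ (λ z → length-filterᵇ-∷ (member z) u us) ⟩
  ∑[ z < n ] (𝟙 (member z u) + length (filterᵇ (member z) us))
    ≡⟨ ∑-distrib-+ (λ z → 𝟙 (member z u)) (λ z → length (filterᵇ (member z) us)) ⟩
  ∑[ z < n ] 𝟙 (member z u) + ∑[ z < n ] length (filterᵇ (member z) us)
    ≡⟨ cong (_+ ∑[ z < n ] length (filterᵇ (member z) us)) (sym (∣p∣≡∑𝟙 (f u))) ⟩
  ∣ f u ∣ + ∑[ z < n ] length (filterᵇ (member z) us)
    ≤⟨ +-mono-≤ (∣f∣≤b u) (∑-length-filterᵇ≤ f ∣f∣≤b us) ⟩
  b + length us * b ∎
  where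
  open ≤-Reasoning
  member : Fin n → A → Bool
  member z u = lookup (f u) z

module GreedyHittingSet {A : Set} {m b : ℕ} (f : A → Subset (suc m))
  (∣∁f∣≤b : ∀ u → ∣ ∁ (f u) ∣ ≤ b) (targets : List A) where

  private
    n : ℕ
    n = suc m

  Hits : Subset n → A → Set
  Hits S u = Nonempty (f u ∩ S)

  missedBy : Fin n → A → Bool
  missedBy z u = lookup (∁ (f u)) z

  record Stage (t : ℕ) : Set where
    field
      chosen     : Subset n
      pending    : List A
      covered    : ∀ {u} → u ∈ₗ targets → u ∈ₗ pending ⊎ Hits chosen u
      ∣chosen∣≤t : ∣ chosen ∣ ≤ t
      decay      : n ^ t * length pending ≤ length targets * b ^ t

  cover-step : ∀ {S pending} z → (∀ {u} → u ∈ₗ targets → u ∈ₗ pending ⊎ Hits S u) →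
    ∀ {u} → u ∈ₗ targets → u ∈ₗ filterᵇ (missedBy z) pending ⊎ Hits (S ∪ ⁅ z ⁆) u
  cover-step z covered u∈targets with covered u∈targets
  ... | inj₂ S-hits = inj₂ (Nonempty-∩-mono (p⊆p∪q ⁅ z ⁆) S-hits)
  ... | inj₁ u∈pending with ∈-filterᵇ⊎rejected (missedBy z) u∈pending
  ...   | inj₁ u∈survivors = inj₁ u∈survivors
  ...   | inj₂ z∈fu = inj₂ (z , x∈p∩q⁺ (lookup-∁≡false⇒∈ z∈fu , x∈p∪q⁺ (inj₂ (x∈⁅x⁆ z))))

  next : ∀ {t} → Stage t → Stage (suc t)
  next {t} st = record
    { chosen     = chosen ∪ ⁅ z ⁆
    ; pending    = survivors z
    ; covered    = cover-step z covered
    ; ∣chosen∣≤t = ≤-trans (∣p∪⁅x⁆∣≤1+∣p∣ chosen z) (s≤s ∣chosen∣≤t)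
    ; decay      =
        *-bound-trans {c = length targets} {n} {n ^ t} {b} {b ^ t} survivors-decay decay
    }
    where
    open Stage st

    survivors : Fin n → List A
    survivors z = filterᵇ (missedBy z) pending

    rarest : ∃ λ z → n * length (survivors z) ≤ ∑[ w < n ] length (survivors w)
    rarest = ∃-*≤∑ (length ∘ survivors)

    z : Fin n
    z = proj₁ rarest

    survivors-decay : n * length (survivors z) ≤ length pending * b
    survivors-decay = ≤-trans (proj₂ rarest) (∑-length-filterᵇ≤ (∁ ∘ f) ∣∁f∣≤b pending)

  stage : ∀ t → Stage t
  stage zero    = record
    { chosen = ⊥ ; pending = targets ; covered = inj₁
    ; ∣chosen∣≤t = ≤-reflexive (∣⊥∣≡0 n) ; decay = ≤-reflexive (*-comm 1 (length targets)) }
  stage (suc t) = next (stage t)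

  hitting-set : ∀ s → length targets * b ^ s < n ^ s → s ≤ n →
    ∃ λ S → ∣ S ∣ ≡ s × (∀ {u} → u ∈ₗ targets → Hits S u)
  hitting-set s decayed s≤n with stage s
  ... | record { pending = _ ∷ rest ; decay = decay } =
    contradiction (≤-trans (m≤m*n (n ^ s) (suc (length rest))) decay) (<⇒≱ decayed)
  ... | record { chosen = S ; pending = [] ; covered = covered ; ∣chosen∣≤t = ∣S∣≤s }
    with ⊆-interpolate s ⊆⊤ ∣S∣≤s (≤-trans s≤n (≤-reflexive (sym (∣⊤∣≡n n))))
  ...   | S′ , S⊆S′ , _ , ∣S′∣≡s =
    S′ , ∣S′∣≡s , λ u∈targets → Nonempty-∩-mono S⊆S′ ([ (λ ()) , id ]′ (covered u∈targets))

separator : ∀ {n} → Graph n → Fin n × Fin n → Subset n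
separator G (x , y) with x ≟ y
... | yes _ = N[ x ] G
... | no  _ = N[ x ] G ∆ N[ y ] G

Separates : ∀ {n} → Graph n → Subset n → Fin n × Fin n → Set
Separates G D u = Nonempty (separator G u ∩ D)

module _ {n} {G : Graph n} {D : Subset n} where

  identifying⇒separates : Identifying G D → ∀ u → Separates G D u
  identifying⇒separates (dominating , distinguishing) (x , y) with x ≟ y
  ... | yes _   = dominating x
  ... | no x≢y  = subst Nonempty (sym (∩-distribʳ-∆ (N[ x ] G) (N[ y ] G) D))
                    (≢⇒Nonempty-∆ (distinguishing x y x≢y))

  separates⇒dominates : ∀ {x} → Separates G D (x , x) → Nonempty (N[ x ] G ∩ D)
  separates⇒dominates {x} separated with x ≟ x
  ... | yes _  = separated
  ... | no x≢x = contradiction refl x≢x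

  separates⇒distinguishes : ∀ {x y} → x ≢ y → Separates G D (x , y) →
    N[ x ] G ∩ D ≢ N[ y ] G ∩ D
  separates⇒distinguishes {x} {y} x≢y separated with x ≟ y
  ... | yes x≡y = contradiction x≡y x≢y
  ... | no _    = Nonempty-∆⇒≢ (subst Nonempty (∩-distribʳ-∆ (N[ x ] G) (N[ y ] G) D) separated)

  separates-ordered⇒identifying : (∀ x y → x Fin.≤ y → Separates G D (x , y)) → Identifying G D
  separates-ordered⇒identifying separated =
    (λ x → separates⇒dominates (separated x x Fin.≤-refl)) , distinguish
    where
    distinguish : ∀ x y → x ≢ y → N[ x ] G ∩ D ≢ N[ y ] G ∩ D
    distinguish x y x≢y with Fin.≤-total x y
    ... | inj₁ x≤y = separates⇒distinguishes x≢y (separated x y x≤y)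
    ... | inj₂ y≤x = separates⇒distinguishes (x≢y ∘ sym) (separated y x y≤x) ∘ sym

∣∁separator∣≤k∸1 : ∀ {n k G} → InGr n k G → ∀ u → ∣ ∁ (separator G u) ∣ ≤ k ∸ 1
∣∁separator∣≤k∸1 {k = zero} (_ , () , _)
∣∁separator∣≤k∸1 {n} {suc k} {G} (_ , _ , k-sets-identify) u = ≮⇒≥ k≮∣∁S∣
  where
  S : Subset n
  S = separator G u
  k≮∣∁S∣ : ¬ k < ∣ ∁ S ∣
  k≮∣∁S∣ k<∣∁S∣ with ⊆-interpolate (suc k) ⊥⊆ (≤-trans (≤-reflexive (∣⊥∣≡0 n)) z≤n) k<∣∁S∣
  ... | q , _ , q⊆∁S , ∣q∣≡k with identifying⇒separates (k-sets-identify q ∣q∣≡k) u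
  ...   | z , z∈S∩q with x∈p∩q⁻ S q z∈S∩q
  ...     | z∈S , z∈q = x∈∁p⇒x∉p (q⊆∁S z∈q) z∈S

orderedPairs : ∀ n → List (Fin n × Fin n)
orderedPairs zero    = []
orderedPairs (suc n) = map (zero ,_) (allFin (suc n)) ++ map (Prod.map suc suc) (orderedPairs n)

length-orderedPairs : ∀ n → length (orderedPairs n) ≡ (n + 1) C 2
length-orderedPairs n = trans (length≡1+nC2 n) (cong (_C 2) (+-comm 1 n))
  where
  length≡1+nC2 : ∀ n → length (orderedPairs n) ≡ suc n C 2
  length≡1+nC2 zero    = refl
  length≡1+nC2 (suc n) = begin
    length (firstRow ++ map (Prod.map suc suc) (orderedPairs n))
      ≡⟨ length-++ firstRow ⟩
    length firstRow + length (map (Prod.map suc suc) (orderedPairs n))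
      ≡⟨ cong₂ _+_ (trans (length-map _ (allFin (suc n))) (length-tabulate id))
                   (trans (length-map _ (orderedPairs n)) (length≡1+nC2 n)) ⟩
    suc n + suc n C 2
      ≡⟨ cong (_+ suc n C 2) (sym (nC1≡n (suc n))) ⟩
    suc n C 1 + suc n C 2
      ≡⟨ nCk+nC[k+1]≡[n+1]C[k+1] (suc n) 1 ⟩
    suc (suc n) C 2 ∎
    where
    open ≡-Reasoning
    firstRow : List (Fin (suc n) × Fin (suc n))
    firstRow = map (zero ,_) (allFin (suc n))

∈-orderedPairs : ∀ {n} {x y : Fin n} → x Fin.≤ y → (x , y) ∈ₗ orderedPairs n
∈-orderedPairs {suc n} {zero}  {y}     _         = ∈-++⁺ˡ (∈-map⁺ (zero ,_) (∈-allFin y))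
∈-orderedPairs {suc n} {suc x} {suc y} (s≤s x≤y) =
  ∈-++⁺ʳ (map (zero ,_) (allFin (suc n))) (∈-map⁺ (Prod.map suc suc) (∈-orderedPairs x≤y))

-- The hypothesis 2 ≤ k only makes the logarithmic form of the bound meaningful;
-- the argument needs just 1 ≤ k, which is part of InGr.
theorem32 : (n k : ℕ) (G : Graph n) → 2 ≤ k → InGr n k G →
    (s : ℕ) → ((n + 1) C 2) * (k ∸ 1) ^ s < n ^ s → s ≤ n →
    ∃ λ (C : Subset n) → (∣ C ∣ ≡ s) × Identifying G C
theorem32 zero    k G _ (k≤0 , 1≤k , _) s _ _ = contradiction (≤-trans 1≤k k≤0) λ ()
theorem32 (suc m) k G _ G∈Gr s decayed s≤n =
  let D , ∣D∣≡s , D-separates = hitting-set s decayed′ s≤n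
  in  D , ∣D∣≡s , separates-ordered⇒identifying λ x y x≤y → D-separates (∈-orderedPairs x≤y)
  where
  open GreedyHittingSet (separator G) (∣∁separator∣≤k∸1 G∈Gr) (orderedPairs (suc m))

  decayed′ : length (orderedPairs (suc m)) * (k ∸ 1) ^ s < suc m ^ s
  decayed′ = subst (λ l → l * (k ∸ 1) ^ s < suc m ^ s) (sym (length-orderedPairs (suc m))) decayed
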